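{- Let $G$ be a finite solvable group with chief series $1=N_{0}\subset N_{1}\subset\dots\subset N_{k}=G$, and let $\rho_{i}(H)=N_{i}H\cap N_{i+1}$. If $E\subset F$ is a cover relation in $L(G)$ (i.e. $E$ is a maximal subgroup of $F$) that is weakly separated by $N_{i+1}/N_{i}$, then $\rho_{i}(E)\subset\rho_{i}(F)$ is a cover relation in the lattice $\mathcal{N}_{i}(E)$ (i.e. $\rho_i(E)\neq\rho_i(F)$ and no element of $\mathcal{N}_{i}(E)$ lies strictly between them).
   Context: $L(G)$ is the subgroup lattice of $G$. An edge $E\subset F$ is weakly separated by $N_{i+1}/N_{i}$ if $N_{i}\cap E=N_{i}\cap F$ and $N_{i+1}E=N_{i+1}F$. For a subgroup $H$, $\mathcal{N}_{i}(H)$ is the set of subgroups $K$ of $G$ with $N_{i}\le K\le N_{i+1}$ normalized by $H$, ordered by inclusion. -}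

module Defs where

open import Level using (Level; _⊔_)
open import Algebra.Bundles using (Group)
open import Data.Nat using (ℕ)
open import Data.Fin using (Fin; zero; suc; inject₁; fromℕ)
open import Data.Product using (Σ; ∃; ∃-syntax; _×_; _,_)
open import Relation.Nullary using (¬_)

module GroupTheory {c ℓ : Level} (G : Group c ℓ) where
  open Group G

  SubsetG : Set (Level.suc (c ⊔ ℓ))
  SubsetG = Carrier → Set (c ⊔ ℓ)

  _⊆_ : SubsetG → SubsetG → Set (c ⊔ ℓ)
  A ⊆ B = ∀ x → A x → B x

  _≐_ : SubsetG → SubsetG → Set (c ⊔ ℓ)
  A ≐ B = (A ⊆ B) × (B ⊆ A)

  _⊂_ : SubsetG → SubsetG → Set (c ⊔ ℓ)
  A ⊂ B = (A ⊆ B) × ¬ (B ⊆ A)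

  _∩_ : SubsetG → SubsetG → SubsetG
  (A ∩ B) x = A x × B x

  _·_ : SubsetG → SubsetG → SubsetG
  (A · B) x = ∃[ a ] ∃[ b ] (A a × B b × (x ≈ (a ∙ b)))

  trivialG : SubsetG
  trivialG x = Lift′ (x ≈ ε)
    where
    Lift′ : Set ℓ → Set (c ⊔ ℓ)
    Lift′ = Level.Lift (c ⊔ ℓ)

  wholeG : SubsetG
  wholeG x = Level.Lift (c ⊔ ℓ) Data.Unit.⊤
    where import Data.Unit

  record IsSubgroup (H : SubsetG) : Set (c ⊔ ℓ) where
    field
      respects : ∀ {x y} → x ≈ y → H x → H y
      ε∈       : H ε
      ∙∈       : ∀ {x y} → H x → H y → H (x ∙ y)
      ⁻¹∈      : ∀ {x} → H x → H (x ⁻¹)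

  NormalizedBy : SubsetG → SubsetG → Set (c ⊔ ℓ)
  NormalizedBy H K = ∀ h k → H h → K k → K ((h ∙ k) ∙ (h ⁻¹))

  IsNormal : SubsetG → Set (c ⊔ ℓ)
  IsNormal N = IsSubgroup N × NormalizedBy wholeG N

  comm : Carrier → Carrier → Carrier
  comm x y = ((x ⁻¹ ∙ y ⁻¹) ∙ x) ∙ y

  IsFinite : Set (c ⊔ ℓ)
  IsFinite = ∃[ n ] Σ (Fin n → Carrier) (λ f → ∀ x → ∃[ i ] (f i ≈ x))

  IsSolvable : Set (Level.suc (c ⊔ ℓ))
  IsSolvable = ∃[ m ] Σ (Fin (ℕ.suc m) → SubsetG) λ H →
      (∀ j → IsSubgroup (H j))
    × (H zero ≐ trivialG)
    × (H (fromℕ m) ≐ wholeG)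
    × (∀ (j : Fin m) → H (inject₁ j) ⊆ H (suc j))
    × (∀ (j : Fin m) → NormalizedBy (H (suc j)) (H (inject₁ j)))
    × (∀ (j : Fin m) → ∀ x y → H (suc j) x → H (suc j) y → H (inject₁ j) (comm x y))

  IsChiefSeries : (k : ℕ) → (Fin (ℕ.suc k) → SubsetG) → Set (Level.suc (c ⊔ ℓ))
  IsChiefSeries k N =
      (∀ j → IsNormal (N j))
    × (N zero ≐ trivialG)
    × (N (fromℕ k) ≐ wholeG)
    × (∀ (i : Fin k) → N (inject₁ i) ⊂ N (suc i))
    × (∀ (i : Fin k) → ¬ (∃[ M ] (IsNormal M × N (inject₁ i) ⊂ M × M ⊂ N (suc i))))

  CoverIn : (SubsetG → Set (Level.suc (c ⊔ ℓ))) → SubsetG → SubsetG → Set (Level.suc (c ⊔ ℓ))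
  CoverIn P A B = (A ⊂ B) × ¬ (∃[ K ] (P K × A ⊂ K × K ⊂ B))

  IsSubgroup′ : SubsetG → Set (Level.suc (c ⊔ ℓ))
  IsSubgroup′ H = Level.Lift (Level.suc (c ⊔ ℓ)) (IsSubgroup H)

  module Series (k : ℕ) (N : Fin (ℕ.suc k) → SubsetG) (i : Fin k) where
    Nᵢ Nᵢ₊₁ : SubsetG
    Nᵢ = N (inject₁ i)
    Nᵢ₊₁ = N (suc i)

    ρ : SubsetG → SubsetG
    ρ H = (Nᵢ · H) ∩ Nᵢ₊₁

    WeaklySeparated : SubsetG → SubsetG → Set (c ⊔ ℓ)
    WeaklySeparated E F = ((Nᵢ ∩ E) ≐ (Nᵢ ∩ F)) × ((Nᵢ₊₁ · E) ≐ (Nᵢ₊₁ · F))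

    In𝒩 : SubsetG → SubsetG → Set (Level.suc (c ⊔ ℓ))
    In𝒩 H K = Level.Lift (Level.suc (c ⊔ ℓ))
      (IsSubgroup K × (Nᵢ ⊆ K) × (K ⊆ Nᵢ₊₁) × NormalizedBy H K)

-- The argument is a repeated use of Dedekind's modular law A ∩ (B C) = (A ∩ B) C for
-- subgroups C ⊆ A, and of its mirror image.
-- Strictness: if ρᵢ(F) ⊆ ρᵢ(E), the modular law together with Nᵢ ∩ E = Nᵢ ∩ F gives
-- F ∩ Nᵢ₊₁ ⊆ E, and then Nᵢ₊₁ E = Nᵢ₊₁ F gives F ⊆ E.
-- Covering: a K ∈ 𝒩ᵢ(E) strictly between ρᵢ(E) and ρᵢ(F) yields the subgroup F ∩ K E,
-- which lies between E and F; it equals E only if K ⊆ ρᵢ(E), and equals F only if ρᵢ(F) ⊆ K.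
module Submission where

open import Defs
open import Level using (Level; lift)
open import Algebra.Bundles using (Group)
open import Data.Nat using (ℕ)
open import Data.Fin using (Fin)
open import Data.Product using (_×_; _,_; proj₁; proj₂; ∃)
open import Data.Unit using (tt)
open import Relation.Nullary using (¬_)
import Relation.Binary.Reasoning.Setoid as SetoidReasoning

module SubgroupProducts {c ℓ : Level} (G : Group c ℓ) where
  open Group G
  open GroupTheory G
  open import Algebra.Properties.Group G using (y≈x\\z; x≈z//y; ⁻¹-anti-homo-∙; //-rightDividesˡ)
  open SetoidReasoning setoid
  open IsSubgroup

  conj-homo : ∀ h a b → (h ∙ (a ∙ b)) ∙ h ⁻¹ ≈ ((h ∙ a) ∙ h ⁻¹) ∙ ((h ∙ b) ∙ h ⁻¹)
  conj-homo h a b = sym (begin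
    ((h ∙ a) ∙ h ⁻¹) ∙ ((h ∙ b) ∙ h ⁻¹)  ≈⟨ assoc _ _ _ ⟩
    (h ∙ a) ∙ (h ⁻¹ ∙ ((h ∙ b) ∙ h ⁻¹))  ≈⟨ ∙-congˡ (∙-congˡ (assoc _ _ _)) ⟩
    (h ∙ a) ∙ (h ⁻¹ ∙ (h ∙ (b ∙ h ⁻¹)))  ≈⟨ ∙-congˡ (y≈x\\z h _ _ refl) ⟨
    (h ∙ a) ∙ (b ∙ h ⁻¹)                 ≈⟨ assoc _ _ _ ⟩
    h ∙ (a ∙ (b ∙ h ⁻¹))                 ≈⟨ ∙-congˡ (assoc _ _ _) ⟨
    h ∙ ((a ∙ b) ∙ h ⁻¹)                 ≈⟨ assoc _ _ _ ⟨
    (h ∙ (a ∙ b)) ∙ h ⁻¹                 ∎)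

  ∙-conj-shuffle : ∀ k e k′ e′ → (k ∙ e) ∙ (k′ ∙ e′) ≈ (k ∙ ((e ∙ k′) ∙ e ⁻¹)) ∙ (e ∙ e′)
  ∙-conj-shuffle k e k′ e′ = sym (begin
    (k ∙ ((e ∙ k′) ∙ e ⁻¹)) ∙ (e ∙ e′)  ≈⟨ assoc _ _ _ ⟩
    k ∙ (((e ∙ k′) ∙ e ⁻¹) ∙ (e ∙ e′))  ≈⟨ ∙-congˡ (assoc _ _ _) ⟩
    k ∙ ((e ∙ k′) ∙ (e ⁻¹ ∙ (e ∙ e′)))  ≈⟨ ∙-congˡ (∙-congˡ (y≈x\\z e e′ _ refl)) ⟨
    k ∙ ((e ∙ k′) ∙ e′)                 ≈⟨ ∙-congˡ (assoc _ _ _) ⟩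
    k ∙ (e ∙ (k′ ∙ e′))                 ≈⟨ assoc _ _ _ ⟨
    (k ∙ e) ∙ (k′ ∙ e′)                 ∎)

  ⁻¹-conj-shuffle : ∀ k e → (k ∙ e) ⁻¹ ≈ ((e ⁻¹ ∙ k ⁻¹) ∙ (e ⁻¹) ⁻¹) ∙ e ⁻¹
  ⁻¹-conj-shuffle k e = trans (⁻¹-anti-homo-∙ k e) (sym (//-rightDividesˡ (e ⁻¹) _))

  ∩-isSubgroup : ∀ {A B} → IsSubgroup A → IsSubgroup B → IsSubgroup (A ∩ B)
  ∩-isSubgroup sA sB = record
    { respects = λ eq (a , b) → respects sA eq a , respects sB eq b
    ; ε∈       = ε∈ sA , ε∈ sB
    ; ∙∈       = λ (a , b) (a′ , b′) → ∙∈ sA a a′ , ∙∈ sB b b′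
    ; ⁻¹∈      = λ (a , b) → ⁻¹∈ sA a , ⁻¹∈ sB b
    }

  ·-isSubgroup : ∀ {K H} → IsSubgroup K → IsSubgroup H → NormalizedBy H K → IsSubgroup (K · H)
  ·-isSubgroup {K} {H} sK sH nK = record
    { respects = λ eq (a , b , ka , hb , x≈) → a , b , ka , hb , trans (sym eq) x≈
    ; ε∈       = ε , ε , ε∈ sK , ε∈ sH , sym (identityˡ ε)
    ; ∙∈       = λ { (k , e , kk , he , x≈) (k′ , e′ , kk′ , he′ , y≈) →
        k ∙ ((e ∙ k′) ∙ e ⁻¹) , e ∙ e′ , ∙∈ sK kk (nK e k′ he kk′) , ∙∈ sH he he′
        , trans (∙-cong x≈ y≈) (∙-conj-shuffle k e k′ e′) }
    ; ⁻¹∈      = λ { (k , e , kk , he , x≈) →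
        (e ⁻¹ ∙ k ⁻¹) ∙ (e ⁻¹) ⁻¹ , e ⁻¹ , nK (e ⁻¹) (k ⁻¹) (⁻¹∈ sH he) (⁻¹∈ sK kk) , ⁻¹∈ sH he
        , trans (⁻¹-cong x≈) (⁻¹-conj-shuffle k e) }
    }

  normalizedBy-anti : ∀ {H H′ K} → H′ ⊆ H → NormalizedBy H K → NormalizedBy H′ K
  normalizedBy-anti H′⊆H nK h k hh kk = nK h k (H′⊆H h hh) kk

  normal⇒normalizedBy : ∀ {H N} → NormalizedBy wholeG N → NormalizedBy H N
  normal⇒normalizedBy = normalizedBy-anti (λ _ _ → lift tt)

  ∩-normalizedBy : ∀ {H A B} → NormalizedBy H A → NormalizedBy H B → NormalizedBy H (A ∩ B)
  ∩-normalizedBy nA nB h x hh (ax , bx) = nA h x hh ax , nB h x hh bx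

  ·-normalizedBy : ∀ {H N} → IsSubgroup H → NormalizedBy wholeG N → NormalizedBy H (N · H)
  ·-normalizedBy sH nN h x hh (n , f , nn , hf , x≈) =
    (h ∙ n) ∙ h ⁻¹ , (h ∙ f) ∙ h ⁻¹ , nN h n (lift tt) nn , ∙∈ sH (∙∈ sH hh hf) (⁻¹∈ sH hh)
    , trans (∙-congʳ (∙-congˡ x≈)) (conj-homo h n f)

  ·-mono : ∀ {A A′ B B′} → A ⊆ A′ → B ⊆ B′ → (A · B) ⊆ (A′ · B′)
  ·-mono A⊆A′ B⊆B′ x (a , b , aa , bb , x≈) = a , b , A⊆A′ a aa , B⊆B′ b bb , x≈

  ·-assocˡ : ∀ {A B C} → (A · (B · C)) ⊆ ((A · B) · C)
  ·-assocˡ x (a , y , aa , (b , c , bb , cc , y≈) , x≈) =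
    a ∙ b , c , (a , b , aa , bb , refl) , cc , trans x≈ (trans (∙-congˡ y≈) (sym (assoc a b c)))

  ·-least : ∀ {A B H} → IsSubgroup H → A ⊆ H → B ⊆ H → (A · B) ⊆ H
  ·-least sH A⊆H B⊆H x (a , b , aa , bb , x≈) = respects sH (sym x≈) (∙∈ sH (A⊆H a aa) (B⊆H b bb))

  ⊆-·ʳ : ∀ {A B} → IsSubgroup B → A ⊆ (A · B)
  ⊆-·ʳ sB x ax = x , ε , ax , ε∈ sB , sym (identityʳ x)

  ⊆-·ˡ : ∀ {A B} → IsSubgroup A → B ⊆ (A · B)
  ⊆-·ˡ sA x bx = ε , x , ε∈ sA , bx , sym (identityˡ x)

  modularʳ : ∀ {A E F} → IsSubgroup F → E ⊆ F → (F ∩ (A · E)) ⊆ ((F ∩ A) · E)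
  modularʳ sF E⊆F x (fx , a , e , aa , ee , x≈) =
    a , e , (respects sF (sym (x≈z//y a e x (sym x≈))) (∙∈ sF fx (⁻¹∈ sF (E⊆F e ee))) , aa) , ee , x≈

  modularˡ : ∀ {A B K} → IsSubgroup K → A ⊆ K → (K ∩ (A · B)) ⊆ (A · (K ∩ B))
  modularˡ sK A⊆K x (kx , a , b , aa , bb , x≈) =
    a , b , aa , (respects sK (sym (y≈x\\z a b x (sym x≈))) (∙∈ sK (⁻¹∈ sK (A⊆K a aa)) kx) , bb) , x≈

module ChiefFactor {c ℓ : Level} (G : Group c ℓ)
                   (k : ℕ) (N : Fin (ℕ.suc k) → GroupTheory.SubsetG G)
                   (cs : GroupTheory.IsChiefSeries G k N) (i : Fin k) where
  open GroupTheory G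
  open Series k N i
  open SubgroupProducts G
  open IsSubgroup

  Nᵢ-isSubgroup : IsSubgroup Nᵢ
  Nᵢ-isSubgroup = proj₁ (proj₁ cs _)

  Nᵢ₊₁-isSubgroup : IsSubgroup Nᵢ₊₁
  Nᵢ₊₁-isSubgroup = proj₁ (proj₁ cs _)

  Nᵢ-normal : NormalizedBy wholeG Nᵢ
  Nᵢ-normal = proj₂ (proj₁ cs _)

  Nᵢ₊₁-normal : NormalizedBy wholeG Nᵢ₊₁
  Nᵢ₊₁-normal = proj₂ (proj₁ cs _)

  Nᵢ⊆Nᵢ₊₁ : Nᵢ ⊆ Nᵢ₊₁
  Nᵢ⊆Nᵢ₊₁ = proj₁ (proj₁ (proj₂ (proj₂ (proj₂ cs))) i)

  ρ-mono : ∀ {A B} → A ⊆ B → ρ A ⊆ ρ B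
  ρ-mono A⊆B x (nx , x₁) = ·-mono (λ _ n → n) A⊆B x nx , x₁

  ∩-⊆-ρ : ∀ {H} → (Nᵢ₊₁ ∩ H) ⊆ ρ H
  ∩-⊆-ρ x (x₁ , hx) = ⊆-·ˡ Nᵢ-isSubgroup x hx , x₁

  ρ-∈𝒩 : ∀ {E H} → IsSubgroup H → E ⊆ H → In𝒩 E (ρ H)
  ρ-∈𝒩 sH E⊆H = lift
    ( ∩-isSubgroup (·-isSubgroup Nᵢ-isSubgroup sH (normal⇒normalizedBy Nᵢ-normal)) Nᵢ₊₁-isSubgroup
    , (λ x n → ⊆-·ʳ sH x n , Nᵢ⊆Nᵢ₊₁ x n)
    , (λ _ → proj₂)
    , normalizedBy-anti E⊆H (∩-normalizedBy (·-normalizedBy sH Nᵢ-normal) (normal⇒normalizedBy Nᵢ₊₁-normal)))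

  ρ-reflects-⊆ : ∀ {E F} → IsSubgroup E → IsSubgroup F → E ⊆ F → WeaklySeparated E F →
                 ρ F ⊆ ρ E → F ⊆ E
  ρ-reflects-⊆ {E} {F} sE sF E⊆F (Nᵢ∩E≐Nᵢ∩F , Nᵢ₊₁E≐Nᵢ₊₁F) ρF⊆ρE f ff =
    ·-least sE F∩Nᵢ₊₁⊆E (λ _ e → e) f
      (modularʳ sF E⊆F f (ff , proj₂ Nᵢ₊₁E≐Nᵢ₊₁F f (⊆-·ˡ Nᵢ₊₁-isSubgroup f ff)))
    where
    F∩NᵢE⊆E : (F ∩ (Nᵢ · E)) ⊆ E
    F∩NᵢE⊆E x p = ·-least sE (λ y (fy , ny) → proj₂ (proj₂ Nᵢ∩E≐Nᵢ∩F y (ny , fy))) (λ _ e → e) x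
                    (modularʳ sF E⊆F x p)

    F∩Nᵢ₊₁⊆E : (F ∩ Nᵢ₊₁) ⊆ E
    F∩Nᵢ₊₁⊆E x (fx , x₁) = F∩NᵢE⊆E x (fx , proj₁ (ρF⊆ρE x (∩-⊆-ρ x (x₁ , fx))))

  module _ {E F K : SubsetG} (sK : IsSubgroup K) (Nᵢ⊆K : Nᵢ ⊆ K) where

    ⊆-ρ-of-∩ : K ⊆ ρ F → (K ∩ F) ⊆ E → K ⊆ ρ E
    ⊆-ρ-of-∩ K⊆ρF K∩F⊆E x kx =
      ·-mono (λ _ n → n) K∩F⊆E x (modularˡ sK Nᵢ⊆K x (kx , proj₁ (K⊆ρF x kx))) , proj₂ (K⊆ρF x kx)

    ρ-⊆-of-· : K ⊆ Nᵢ₊₁ → IsSubgroup E → ρ E ⊆ K → F ⊆ (K · E) → ρ F ⊆ K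
    ρ-⊆-of-· K⊆Nᵢ₊₁ sE ρE⊆K F⊆KE x (nf , x₁) =
      ·-least sK (λ _ k → k) (λ y e → ρE⊆K y (∩-⊆-ρ y e)) x (modularˡ Nᵢ₊₁-isSubgroup K⊆Nᵢ₊₁ x (x₁ , KEx))
      where
      KEx : (K · E) x
      KEx = ·-mono (·-least sK (λ _ k → k) (λ _ k → k)) (λ _ e → e) x
              (·-assocˡ x (·-mono Nᵢ⊆K F⊆KE x nf))

  ρ-covers : ∀ {E F} → IsSubgroup E → IsSubgroup F → CoverIn IsSubgroup′ E F →
             ¬ (∃ λ K → In𝒩 E K × ρ E ⊂ K × K ⊂ ρ F)
  ρ-covers {E} {F} sE sF ((E⊆F , _) , no-subgroup-between)
           (K , lift (sK , Nᵢ⊆K , K⊆Nᵢ₊₁ , nK) , (ρE⊆K , K⊈ρE) , (K⊆ρF , ρF⊈K)) =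
    no-subgroup-between (X , lift X-isSubgroup , (E⊆X , X⊈E) , ((λ _ → proj₁) , F⊈X))
    where
    X : SubsetG
    X = F ∩ (K · E)

    X-isSubgroup : IsSubgroup X
    X-isSubgroup = ∩-isSubgroup sF (·-isSubgroup sK sE nK)

    E⊆X : E ⊆ X
    E⊆X e ee = E⊆F e ee , ⊆-·ˡ sK e ee

    X⊈E : ¬ (X ⊆ E)
    X⊈E X⊆E = K⊈ρE (⊆-ρ-of-∩ sK Nᵢ⊆K K⊆ρF (λ x (kx , fx) → X⊆E x (fx , ⊆-·ʳ sE x kx)))

    F⊈X : ¬ (F ⊆ X)
    F⊈X F⊆X = ρF⊈K (ρ-⊆-of-· sK Nᵢ⊆K K⊆Nᵢ₊₁ sE ρE⊆K (λ f ff → proj₂ (F⊆X f ff)))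

mainTheorem6 : ∀ {c ℓ : Level} (G : Group c ℓ) →
    let open GroupTheory G in
    IsFinite → IsSolvable →
    (k : ℕ) (N : Fin (ℕ.suc k) → SubsetG) → IsChiefSeries k N →
    (i : Fin k) → let open Series k N i in
    (E F : SubsetG) → IsSubgroup E → IsSubgroup F →
    CoverIn IsSubgroup′ E F →
    WeaklySeparated E F →
    In𝒩 E (ρ E) × In𝒩 E (ρ F) × CoverIn (In𝒩 E) (ρ E) (ρ F)
mainTheorem6 G _ _ k N cs i E F sE sF cover@((E⊆F , F⊈E) , _) separated =
    ρ-∈𝒩 sE (λ _ e → e)
  , ρ-∈𝒩 sF E⊆F
  , (ρ-mono E⊆F , λ ρF⊆ρE → F⊈E (ρ-reflects-⊆ sE sF E⊆F separated ρF⊆ρE))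
  , ρ-covers sE sF cover
  where open ChiefFactor G k N cs i
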